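{- Consider a position in the $K^4$-building game on a complete graph board $G$ (finite or countably infinite). Let $H$ be a promising graph of one of the six types described in the context, and suppose $H$ is realised in $G$, i.e. there are distinct vertices of $G$, labelled as in the description of that type, such that on these vertices exactly the listed red edges are claimed by the first player, exactly the listed blue edges are claimed by the second player, and all other edges among them (in particular the vulnerable edges) are unclaimed. Suppose it is the first player's turn and that there is no monochromatic $K^4$ on the board and no threat by the second player on the board, even if the vulnerable edges of $H$ are added as edges claimed by the second player. Then there is a sequence of moves for the first player, each one a threat, the last of which creates two threats; thus the first player wins the game.
   Context: The $K^4$-building game: two players, the first player (red) and the second player (blue), alternately (first player starting) each claim exactly one previously unclaimed edge of the board, a complete graph; the first player whose claimed edges contain a $K^4$ wins (on an infinite board, if nobody ever does, the second player wins). $K^4_-$ denotes the graph on 4 vertices with 5 edges. A threat (of a player) is a set of four vertices on which exactly five of the six edges are claimed, all by that player, and the sixth edge is unclaimed. Promising graph types (vertices and edges; all edges not listed are unclaimed; "vulnerable" edges are those which, in the definition of a promising graph, are claimed by the second player, and which are unclaimed in a realised promising graph): Type 1: vertices $a,b,c,d,e$; red: $ab,ac,ad,ae,bc,cd$; blue: $bd$; no vulnerable edges. Type 2: vertices $a,b,c,d,e$; red: $ab,ac,ad,ae,bc$; no blue; vulnerable: $bd$. Type 3: vertices $a,b,c,d,e,f$; red: $ab,ac,ad,ae,af,bc$; blue: $bd,be$; vulnerable: $bf,ce$. Type 4: vertices $a,b,c,d,e,f$; red: $ab,ac,ad,ae,af,bc$; blue: $bd,ef$; vulnerable: $be,bf$.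 Type 5: vertices $a,b,c,d,e,f,g$; red: $ab,ac,ad,ae,af,ag,bc$; blue: $bd,be,bf,ce,df$; vulnerable: $bg,cd,cf$. Type 6: vertices $a,b,c,d,e,f,g$; red: $ab,ac,ad,ae,af,ag,bc$; blue: $bd,be,bf,cd,ce$; vulnerable: $bg,cf,ef$. -}

module Defs where

open import Data.Nat using (ℕ; _<_)
open import Data.Fin using (Fin; #_)
open import Data.List using (List; []; _∷_; _++_; map; length)
open import Data.List.Membership.Propositional using (_∈_)
open import Data.List.Relation.Unary.AllPairs using (AllPairs)
open import Data.Product using (Σ; _×_; _,_)
open import Data.Sum using (_⊎_)
open import Data.Unit using (⊤)
open import Relation.Nullary using (¬_)
open import Relation.Binary.PropositionalEquality using (_≡_; _≢_)

-- The board: complete graph on vertices {0,…,n-1} (finite) or on ℕ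
-- (countably infinite).

data Board : Set where
  finite   : ℕ → Board
  infinite : Board

InBoard : Board → ℕ → Set
InBoard (finite n) v = v < n
InBoard infinite   v = ⊤

-- Positions: the (finite) lists of edges claimed so far by the first
-- player (red) and by the second player (blue).  An edge {u,v} is
-- recorded as an ordered pair (u , v) in either orientation.

record Pos : Set where
  constructor pos
  field
    reds  : List (ℕ × ℕ)
    blues : List (ℕ × ℕ)
open Pos public

data Player : Set where
  red blue : Player

claims : Player → Pos → List (ℕ × ℕ)
claims red  p = reds p
claims blue p = blues p

_∈E_ : ℕ × ℕ → List (ℕ × ℕ) → Set
(u , v) ∈E es = (u , v) ∈ es ⊎ (v , u) ∈ es

Claimed : Player → Pos → ℕ → ℕ → Set
Claimed X p u v = (u , v) ∈E claims X p

Unclaimed : Pos → ℕ → ℕ → Set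
Unclaimed p u v = ¬ Claimed red p u v × ¬ Claimed blue p u v

Free : Board → Pos → ℕ → ℕ → Set
Free b p u v = InBoard b u × InBoard b v × u ≢ v × Unclaimed p u v

SameEdge : ℕ × ℕ → ℕ × ℕ → Set
SameEdge (u , v) (x , y) = (u ≡ x × v ≡ y) ⊎ (u ≡ y × v ≡ x)

Legal : Board → Pos → Set
Legal b p =
  (∀ X u v → Claimed X p u v → InBoard b u × InBoard b v × u ≢ v)
  × (∀ u v → ¬ (Claimed red p u v × Claimed blue p u v))
  × AllPairs (λ e f → ¬ SameEdge e f) (reds p)
  × AllPairs (λ e f → ¬ SameEdge e f) (blues p)

-- it is the first player's turn (red started, so both have made the
-- same number of moves)
RedsTurn : Pos → Set
RedsTurn p = length (reds p) ≡ length (blues p)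

playRed : Pos → ℕ → ℕ → Pos
playRed p u v = pos ((u , v) ∷ reds p) (blues p)

playBlue : Pos → ℕ → ℕ → Pos
playBlue p u v = pos (reds p) ((u , v) ∷ blues p)

Distinct4 : ℕ → ℕ → ℕ → ℕ → Set
Distinct4 a b c d = a ≢ b × a ≢ c × a ≢ d × b ≢ c × b ≢ d × c ≢ d

K4 : Player → Pos → Set
K4 X p = Σ ℕ λ a → Σ ℕ λ b → Σ ℕ λ c → Σ ℕ λ d →
  Distinct4 a b c d
  × Claimed X p a b × Claimed X p a c × Claimed X p a d
  × Claimed X p b c × Claimed X p b d × Claimed X p c d

MonoK4 : Pos → Set
MonoK4 p = K4 red p ⊎ K4 blue p

ThreatAt : Player → Pos → ℕ → ℕ → Set
ThreatAt X p a b = Σ ℕ λ c → Σ ℕ λ d →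
  Distinct4 a b c d
  × Claimed X p a c × Claimed X p a d
  × Claimed X p b c × Claimed X p b d × Claimed X p c d
  × Unclaimed p a b

Threat : Player → Pos → Set
Threat X p = Σ ℕ λ a → Σ ℕ λ b → ThreatAt X p a b

-- The conclusion, part 1: a sequence of red moves, each a threat
-- (blue being forced to answer by claiming the missing edge of the
-- threat), the last of which creates two threats (with different
-- missing edges).

data ThreatSequence (b : Board) (p : Pos) : Set where
  last : ∀ u v x y w z → Free b p u v
       → ThreatAt red (playRed p u v) x y
       → ThreatAt red (playRed p u v) w z
       → ¬ SameEdge (x , y) (w , z)
       → ThreatSequence b p
  step : ∀ u v x y → Free b p u v
       → ThreatAt red (playRed p u v) x y
       → ThreatSequence b (playBlue (playRed p u v) x y)
       → ThreatSequence b p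

-- The conclusion, part 2: the first player wins the game from p
-- (red to move): red has a strategy that claims a red K⁴ after finitely
-- many moves whatever blue does, with blue never completing a K⁴ first.
-- (Inductive = well-founded game tree; if the board fills up without a
-- K⁴ this is not a red win, hence the requirement that blue can move.)

data RedWins (b : Board) (p : Pos) : Set where
  now   : ∀ u v → Free b p u v → K4 red (playRed p u v) → RedWins b p
  later : ∀ u v → Free b p u v
        → (Σ ℕ λ x → Σ ℕ λ y → Free b (playRed p u v) x y)
        → (∀ x y → Free b (playRed p u v) x y →
             ¬ K4 blue (playBlue (playRed p u v) x y)
             × RedWins b (playBlue (playRed p u v) x y))
        → RedWins b p

-- Promising graph types.  Labels a,b,c,d,e,f,g = # 0,…,# 6.

data PType : Set where
  T1 T2 T3 T4 T5 T6 : PType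

nv : PType → ℕ
nv T1 = 5
nv T2 = 5
nv T3 = 6
nv T4 = 6
nv T5 = 7
nv T6 = 7

redE : (t : PType) → List (Fin (nv t) × Fin (nv t))
redE T1 = (# 0 , # 1) ∷ (# 0 , # 2) ∷ (# 0 , # 3) ∷ (# 0 , # 4) ∷ (# 1 , # 2) ∷ (# 2 , # 3) ∷ []
redE T2 = (# 0 , # 1) ∷ (# 0 , # 2) ∷ (# 0 , # 3) ∷ (# 0 , # 4) ∷ (# 1 , # 2) ∷ []
redE T3 = (# 0 , # 1) ∷ (# 0 , # 2) ∷ (# 0 , # 3) ∷ (# 0 , # 4) ∷ (# 0 , # 5) ∷ (# 1 , # 2) ∷ []
redE T4 = (# 0 , # 1) ∷ (# 0 , # 2) ∷ (# 0 , # 3) ∷ (# 0 , # 4) ∷ (# 0 , # 5) ∷ (# 1 , # 2) ∷ []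
redE T5 = (# 0 , # 1) ∷ (# 0 , # 2) ∷ (# 0 , # 3) ∷ (# 0 , # 4) ∷ (# 0 , # 5) ∷ (# 0 , # 6) ∷ (# 1 , # 2) ∷ []
redE T6 = (# 0 , # 1) ∷ (# 0 , # 2) ∷ (# 0 , # 3) ∷ (# 0 , # 4) ∷ (# 0 , # 5) ∷ (# 0 , # 6) ∷ (# 1 , # 2) ∷ []

blueE : (t : PType) → List (Fin (nv t) × Fin (nv t))
blueE T1 = (# 1 , # 3) ∷ []
blueE T2 = []
blueE T3 = (# 1 , # 3) ∷ (# 1 , # 4) ∷ []
blueE T4 = (# 1 , # 3) ∷ (# 4 , # 5) ∷ []
blueE T5 = (# 1 , # 3) ∷ (# 1 , # 4) ∷ (# 1 , # 5) ∷ (# 2 , # 4) ∷ (# 3 , # 5) ∷ []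
blueE T6 = (# 1 , # 3) ∷ (# 1 , # 4) ∷ (# 1 , # 5) ∷ (# 2 , # 3) ∷ (# 2 , # 4) ∷ []

vulnE : (t : PType) → List (Fin (nv t) × Fin (nv t))
vulnE T1 = []
vulnE T2 = (# 1 , # 3) ∷ []
vulnE T3 = (# 1 , # 5) ∷ (# 2 , # 4) ∷ []
vulnE T4 = (# 1 , # 4) ∷ (# 1 , # 5) ∷ []
vulnE T5 = (# 1 , # 6) ∷ (# 2 , # 3) ∷ (# 2 , # 5) ∷ []
vulnE T6 = (# 1 , # 6) ∷ (# 2 , # 5) ∷ (# 4 , # 5) ∷ []

_∈L_ : ∀ {k} → Fin k × Fin k → List (Fin k × Fin k) → Set
(i , j) ∈L l = (i , j) ∈ l ⊎ (j , i) ∈ l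

Realised : Board → Pos → (t : PType) → (Fin (nv t) → ℕ) → Set
Realised b p t φ =
  (∀ i → InBoard b (φ i))
  × (∀ i j → φ i ≡ φ j → i ≡ j)
  × (∀ i j → i ≢ j →
       ((Claimed red p (φ i) (φ j) → (i , j) ∈L redE t) × ((i , j) ∈L redE t → Claimed red p (φ i) (φ j)))
     × ((Claimed blue p (φ i) (φ j) → (i , j) ∈L blueE t) × ((i , j) ∈L blueE t → Claimed blue p (φ i) (φ j))))

addVulnerable : Pos → (t : PType) → (Fin (nv t) → ℕ) → Pos
addVulnerable p t φ = pos (reds p) (map (λ { (i , j) → (φ i , φ j) }) (vulnE t) ++ blues p)

-- Red plays a fixed sequence of moves inside the promising graph H.  Each move but the last
-- creates a single threat whose missing edge is a vulnerable edge of H, so blue must claim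
-- it; the last move creates two threats, and red completes a K⁴ next.  The moves depend only
-- on the labelled pattern of H, so they are checked there by computation.  Blue never
-- completes a K⁴ on the way: all blue edges lie in the position with the vulnerable edges
-- added, so a blue K⁴ made by one new blue edge would be a blue K⁴ or a blue threat there.
{-# OPTIONS --safe #-}
module Submission where

open import Defs
open import Data.Nat using (ℕ)
open import Data.Fin using (Fin; #_)
open import Data.Product using (_×_)
open import Relation.Nullary using (¬_)

import Data.Nat as ℕ
import Data.Fin as Fin
open import Data.Product using (_,_; proj₁; proj₂; uncurry)
open import Data.Product.Properties using (≡-dec; ,-injectiveˡ; ,-injectiveʳ)
open import Data.Sum as Sum using (_⊎_; inj₁; inj₂)
open import Data.Empty using (⊥)
open import Data.Unit using (tt)
open import Data.List using (List; []; _∷_; _++_; map)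
open import Data.List.Relation.Unary.Any using (here; there)
open import Data.List.Membership.Propositional using (_∈_)
open import Data.List.Membership.Propositional.Properties
  using (∈-map⁺; ∈-map⁻; ∈-++⁺ˡ; ∈-++⁺ʳ; ∈-++⁻)
import Data.List.Membership.DecPropositional as DecMembership
open import Function using (_∘_)
open import Function.Bundles using (_⇔_; mk⇔; Equivalence)
open import Relation.Nullary using (Dec; yes; no)
open import Relation.Nullary.Decidable using (toWitness; _×-dec_; _⊎-dec_; ¬?)
open import Relation.Binary.PropositionalEquality using (_≡_; _≢_; refl; ≢-sym)

open Equivalence using (to; from)

-- `_∈E_` and `_∈L_` unfold to this, so the lemmas below serve both.

_∈ᵘ_ : {A : Set} → A × A → List (A × A) → Set
(u , v) ∈ᵘ xs = (u , v) ∈ xs ⊎ (v , u) ∈ xs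

module _ {A : Set} {u v : A} where

  ∈ᵘ-++⁺ˡ : ∀ {xs ys} → (u , v) ∈ᵘ xs → (u , v) ∈ᵘ (xs ++ ys)
  ∈ᵘ-++⁺ˡ = Sum.map ∈-++⁺ˡ ∈-++⁺ˡ

  ∈ᵘ-++⁺ʳ : ∀ xs {ys} → (u , v) ∈ᵘ ys → (u , v) ∈ᵘ (xs ++ ys)
  ∈ᵘ-++⁺ʳ xs = Sum.map (∈-++⁺ʳ xs) (∈-++⁺ʳ xs)

  ∈ᵘ-++⁻ : ∀ xs {ys} → (u , v) ∈ᵘ (xs ++ ys) → (u , v) ∈ᵘ xs ⊎ (u , v) ∈ᵘ ys
  ∈ᵘ-++⁻ xs (inj₁ m) = Sum.map inj₁ inj₁ (∈-++⁻ xs m)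
  ∈ᵘ-++⁻ xs (inj₂ m) = Sum.map inj₂ inj₂ (∈-++⁻ xs m)

  ∈ᵘ-∷⁺ : ∀ {e xs ys} → ((u , v) ∈ᵘ xs → (u , v) ∈ᵘ ys) → (u , v) ∈ᵘ (e ∷ xs) → (u , v) ∈ᵘ (e ∷ ys)
  ∈ᵘ-∷⁺ sub (inj₁ (here eq)) = inj₁ (here eq)
  ∈ᵘ-∷⁺ sub (inj₂ (here eq)) = inj₂ (here eq)
  ∈ᵘ-∷⁺ sub (inj₁ (there m)) = Sum.map there there (sub (inj₁ m))
  ∈ᵘ-∷⁺ sub (inj₂ (there m)) = Sum.map there there (sub (inj₂ m))

SameEdge-swapˡ : ∀ {a b e} → SameEdge (a , b) e → SameEdge (b , a) e
SameEdge-swapˡ (inj₁ (refl , refl)) = inj₂ (refl , refl)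
SameEdge-swapˡ (inj₂ (refl , refl)) = inj₁ (refl , refl)

SameEdge⇒∈ᵘ : ∀ {e f es} → SameEdge e f → e ∈ᵘ (f ∷ es)
SameEdge⇒∈ᵘ (inj₁ (refl , refl)) = inj₁ (here refl)
SameEdge⇒∈ᵘ (inj₂ (refl , refl)) = inj₂ (here refl)

sameEdge? : (e f : ℕ × ℕ) → Dec (SameEdge e f)
sameEdge? (u , v) (x , y) = ((u ℕ.≟ x) ×-dec (v ℕ.≟ y)) ⊎-dec ((u ℕ.≟ y) ×-dec (v ℕ.≟ x))

SameEdge-shared : ∀ {a a' b b' e} → SameEdge (a , a') e → SameEdge (b , b') e → a ≢ b → a ≢ b' → ⊥
SameEdge-shared (inj₁ (refl , refl)) (inj₁ (refl , refl)) a≢b a≢b' = a≢b refl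
SameEdge-shared (inj₁ (refl , refl)) (inj₂ (refl , refl)) a≢b a≢b' = a≢b' refl
SameEdge-shared (inj₂ (refl , refl)) (inj₁ (refl , refl)) a≢b a≢b' = a≢b' refl
SameEdge-shared (inj₂ (refl , refl)) (inj₂ (refl , refl)) a≢b a≢b' = a≢b refl

_⊑_ : Pos → Pos → Set
q ⊑ q' = ∀ X u v → Claimed X q u v → Claimed X q' u v

playRed-mono : ∀ {q q' x y} → q ⊑ q' → playRed q x y ⊑ playRed q' x y
playRed-mono q⊑q' red  u v = ∈ᵘ-∷⁺ (q⊑q' red u v)
playRed-mono q⊑q' blue u v = q⊑q' blue u v

playBlue-mono : ∀ {q q' x y} → q ⊑ q' → playBlue q x y ⊑ playBlue q' x y
playBlue-mono q⊑q' red  u v = q⊑q' red u v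
playBlue-mono q⊑q' blue u v = ∈ᵘ-∷⁺ (q⊑q' blue u v)

playBlue-swap : ∀ {q x y} → playBlue q x y ⊑ playBlue q y x
playBlue-swap red  u v c = c
playBlue-swap blue u v (inj₁ (here refl)) = inj₂ (here refl)
playBlue-swap blue u v (inj₂ (here refl)) = inj₁ (here refl)
playBlue-swap blue u v (inj₁ (there m))   = inj₁ (there m)
playBlue-swap blue u v (inj₂ (there m))   = inj₂ (there m)

Free-anti-mono : ∀ {b q q' u v} → q' ⊑ q → Free b q u v → Free b q' u v
Free-anti-mono q'⊑q (bu , bv , u≢v , ¬red , ¬blue) =
  bu , bv , u≢v , ¬red ∘ q'⊑q red _ _ , ¬blue ∘ q'⊑q blue _ _

K4-mono : ∀ {X q q'} → q ⊑ q' → K4 X q → K4 X q'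
K4-mono {X} {q} {q'} q⊑q' (a , b , c , d , D , ab , ac , ad , bc , bd , cd) =
  a , b , c , d , D , cl ab , cl ac , cl ad , cl bc , cl bd , cl cd
  where
  cl : ∀ {u v} → Claimed X q u v → Claimed X q' u v
  cl = q⊑q' X _ _

Free-playBlue : ∀ {b q x y u v} → ¬ SameEdge (x , y) (u , v) → Free b q u v → Free b (playBlue q x y) u v
Free-playBlue {q = q} {x} {y} {u} {v} xy≠uv (bu , bv , u≢v , ¬red , ¬blue) = bu , bv , u≢v , ¬red , ¬blue′
  where
  ¬blue′ : ¬ Claimed blue (playBlue q x y) u v
  ¬blue′ (inj₁ (here refl)) = xy≠uv (inj₁ (refl , refl))
  ¬blue′ (inj₂ (here refl)) = xy≠uv (inj₂ (refl , refl))
  ¬blue′ (inj₁ (there m))   = ¬blue (inj₁ m)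
  ¬blue′ (inj₂ (there m))   = ¬blue (inj₂ m)

ThreatAt⇒Free : ∀ {b q x y} → InBoard b x → InBoard b y → ThreatAt red q x y → Free b q x y
ThreatAt⇒Free bx by (_ , _ , (x≢y , _) , _ , _ , _ , _ , _ , unclaimed) = bx , by , x≢y , unclaimed

ThreatAt⇒K4 : ∀ {q x y} → ThreatAt red q x y → K4 red (playRed q x y)
ThreatAt⇒K4 {q} {x} {y} (c , d , D , xc , xd , yc , yd , cd , _) =
  x , y , c , d , D , inj₁ (here refl) , old xc , old xd , old yc , old yd , old cd
  where
  old : ∀ {u v} → Claimed red q u v → Claimed red (playRed q x y) u v
  old = Sum.map there there

RedWins-resp : ∀ {b q q'} → q ⊑ q' → q' ⊑ q → RedWins b q → RedWins b q'
RedWins-resp q⊑q' q'⊑q (now u v free k4) =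
  now u v (Free-anti-mono q'⊑q free) (K4-mono {red} (playRed-mono q⊑q') k4)
RedWins-resp {b} {q} {q'} q⊑q' q'⊑q (later u v free (x , y , free′) reply) =
  later u v (Free-anti-mono q'⊑q free) (x , y , Free-anti-mono after⊒ free′) reply′
  where
  after⊑ : playRed q u v ⊑ playRed q' u v
  after⊑ = playRed-mono q⊑q'
  after⊒ : playRed q' u v ⊑ playRed q u v
  after⊒ = playRed-mono q'⊑q
  reply′ : ∀ x y → Free b (playRed q' u v) x y
         → ¬ K4 blue (playBlue (playRed q' u v) x y) × RedWins b (playBlue (playRed q' u v) x y)
  reply′ x y free″ with reply x y (Free-anti-mono after⊑ free″)
  ... | ¬k4 , wins = ¬k4 ∘ K4-mono {blue} (playBlue-mono after⊒) ,
                     RedWins-resp (playBlue-mono after⊑) (playBlue-mono after⊒) wins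

BlueSafe : Board → Pos → Set
BlueSafe b q = ∀ x y → Free b q x y → ¬ K4 blue (playBlue q x y)

module _ {b q u v} (free : Free b q u v) (safe : BlueSafe b (playRed q u v)) where

  private
    q′ : Pos
    q′ = playRed q u v

    Reply : Set
    Reply = ∀ x′ y′ → Free b q′ x′ y′ → ¬ K4 blue (playBlue q′ x′ y′) × RedWins b (playBlue q′ x′ y′)

  forcingMove : ∀ {x y} → InBoard b x → InBoard b y → ThreatAt red q′ x y
              → RedWins b (playBlue q′ x y) → RedWins b q
  forcingMove {x} {y} bx by threat wins = later u v free (x , y , freeXY) reply
    where
    freeXY : Free b q′ x y
    freeXY = ThreatAt⇒Free bx by threat
    reply : Reply
    reply x′ y′ free′ with sameEdge? (x′ , y′) (x , y)
    ... | no  other                = safe x′ y′ free′ , now x y (Free-playBlue other freeXY) (ThreatAt⇒K4 threat)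
    ... | yes (inj₁ (refl , refl)) = safe x′ y′ free′ , wins
    ... | yes (inj₂ (refl , refl)) = safe x′ y′ free′ , RedWins-resp playBlue-swap playBlue-swap wins

  doubleThreat : ∀ {x₁ y₁ x₂ y₂} → InBoard b x₁ → InBoard b y₁ → InBoard b x₂ → InBoard b y₂
               → ThreatAt red q′ x₁ y₁ → ThreatAt red q′ x₂ y₂ → ¬ SameEdge (x₁ , y₁) (x₂ , y₂)
               → RedWins b q
  doubleThreat {x₁} {y₁} {x₂} {y₂} bx₁ by₁ bx₂ by₂ threat₁ threat₂ distinct =
    later u v free (x₁ , y₁ , free₁) reply
    where
    free₁ : Free b q′ x₁ y₁
    free₁ = ThreatAt⇒Free bx₁ by₁ threat₁
    free₂ : Free b q′ x₂ y₂
    free₂ = ThreatAt⇒Free bx₂ by₂ threat₂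
    reply : Reply
    reply x′ y′ free′ with sameEdge? (x′ , y′) (x₁ , y₁)
    ... | no  other                = safe x′ y′ free′ , now x₁ y₁ (Free-playBlue other free₁) (ThreatAt⇒K4 threat₁)
    ... | yes (inj₁ (refl , refl)) = safe x′ y′ free′ , now x₂ y₂ (Free-playBlue distinct free₂) (ThreatAt⇒K4 threat₂)
    ... | yes (inj₂ (refl , refl)) =
      safe x′ y′ free′ , now x₂ y₂ (Free-playBlue (distinct ∘ SameEdge-swapˡ) free₂) (ThreatAt⇒K4 threat₂)

-- A blue K⁴ created by one new edge is a blue K⁴ or a blue threat of any position P containing
-- blue's old edges; the threat's missing edge is unclaimed in P because P's red edges are red.
module _ {P q : Pos} (blue⊆P : ∀ u v → Claimed blue q u v → Claimed blue P u v)
         (red⊇P : ∀ u v → Claimed red P u v → Claimed red q u v)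
         (¬K4 : ¬ K4 blue P) (¬threat : ¬ Threat blue P) where

  private
    module NewEdge {x y : ℕ} (¬red : ¬ Claimed red q x y) where

      Blue⁺ : ℕ → ℕ → Set
      Blue⁺ u v = SameEdge (u , v) (x , y) ⊎ Claimed blue P u v

      swapᴾ : ∀ {u v} → Claimed blue P u v → Claimed blue P v u
      swapᴾ = Sum.swap

      swap : ∀ {u v} → Blue⁺ u v → Blue⁺ v u
      swap = Sum.map SameEdge-swapˡ swapᴾ

      classify : ∀ {u v} → Claimed blue (playBlue q x y) u v → Blue⁺ u v
      classify (inj₁ (here refl)) = inj₁ (inj₁ (refl , refl))
      classify (inj₂ (here refl)) = inj₁ (inj₂ (refl , refl))
      classify (inj₁ (there m))   = inj₂ (blue⊆P _ _ (inj₁ m))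
      classify (inj₂ (there m))   = inj₂ (blue⊆P _ _ (inj₂ m))

      old : ∀ {k l m n} → SameEdge (k , l) (x , y) → k ≢ m → k ≢ n → Blue⁺ m n → Claimed blue P m n
      old new k≢m k≢n (inj₁ new′) with () ← SameEdge-shared new new′ k≢m k≢n
      old new k≢m k≢n (inj₂ c) = c

      unclaimedᴾ : ∀ {u v} → SameEdge (u , v) (x , y) → ¬ Claimed red P u v
      unclaimedᴾ (inj₁ (refl , refl)) = ¬red ∘ red⊇P _ _
      unclaimedᴾ (inj₂ (refl , refl)) = ¬red ∘ Sum.swap ∘ red⊇P _ _

      newEdge : ∀ {k l m n} → Distinct4 k l m n → SameEdge (k , l) (x , y)
              → Blue⁺ k m → Blue⁺ k n → Blue⁺ l m → Blue⁺ l n → Blue⁺ m n → ⊥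
      newEdge {k} {l} {m} {n} D@(k≢l , k≢m , k≢n , l≢m , l≢n , m≢n) new km kn lm ln mn =
        ¬threat (k , l , m , n , D , km′ , kn′ , lm′ , ln′ , mn′ , unclaimedᴾ new , ¬blueᴾ)
        where
        km′ : Claimed blue P k m
        km′ = old (SameEdge-swapˡ new) (≢-sym k≢l) l≢m km
        kn′ : Claimed blue P k n
        kn′ = old (SameEdge-swapˡ new) (≢-sym k≢l) l≢n kn
        lm′ : Claimed blue P l m
        lm′ = old new k≢l k≢m lm
        ln′ : Claimed blue P l n
        ln′ = old new k≢l k≢n ln
        mn′ : Claimed blue P m n
        mn′ = old new k≢m k≢n mn
        ¬blueᴾ : ¬ Claimed blue P k l
        ¬blueᴾ kl = ¬K4 (k , l , m , n , D , kl , km′ , kn′ , lm′ , ln′ , mn′)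

      noK4 : ¬ K4 blue (playBlue q x y)
      noK4 (a , b , c , d , D@(a≢b , a≢c , a≢d , b≢c , b≢d , c≢d) , ab , ac , ad , bc , bd , cd)
        with classify ab | classify ac | classify ad | classify bc | classify bd | classify cd
      ... | inj₁ new | ac′ | ad′ | bc′ | bd′ | cd′ = newEdge D new ac′ ad′ bc′ bd′ cd′
      ... | inj₂ ab′ | inj₁ new | ad′ | bc′ | bd′ | cd′ =
        newEdge (a≢c , a≢b , a≢d , ≢-sym b≢c , c≢d , b≢d) new (inj₂ ab′) ad′ (swap bc′) cd′ bd′
      ... | inj₂ ab′ | inj₂ ac′ | inj₁ new | bc′ | bd′ | cd′ =
        newEdge (a≢d , a≢b , a≢c , ≢-sym b≢d , ≢-sym c≢d , b≢c) new
          (inj₂ ab′) (inj₂ ac′) (swap bd′) (swap cd′) bc′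
      ... | inj₂ ab′ | inj₂ ac′ | inj₂ ad′ | inj₁ new | bd′ | cd′ =
        newEdge (b≢c , ≢-sym a≢b , b≢d , ≢-sym a≢c , c≢d , a≢d) new
          (inj₂ (swapᴾ ab′)) bd′ (inj₂ (swapᴾ ac′)) cd′ (inj₂ ad′)
      ... | inj₂ ab′ | inj₂ ac′ | inj₂ ad′ | inj₂ bc′ | inj₁ new | cd′ =
        newEdge (b≢d , ≢-sym a≢b , b≢c , ≢-sym a≢d , ≢-sym c≢d , a≢c) new
          (inj₂ (swapᴾ ab′)) (inj₂ bc′) (inj₂ (swapᴾ ad′)) (swap cd′) (inj₂ ac′)
      ... | inj₂ ab′ | inj₂ ac′ | inj₂ ad′ | inj₂ bc′ | inj₂ bd′ | inj₁ new =
        newEdge (c≢d , ≢-sym a≢c , ≢-sym b≢c , ≢-sym a≢d , ≢-sym b≢d , a≢b) new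
          (inj₂ (swapᴾ ac′)) (inj₂ (swapᴾ bc′)) (inj₂ (swapᴾ ad′)) (inj₂ (swapᴾ bd′)) (inj₂ ab′)
      ... | inj₂ ab′ | inj₂ ac′ | inj₂ ad′ | inj₂ bc′ | inj₂ bd′ | inj₂ cd′ =
        ¬K4 (a , b , c , d , D , ab′ , ac′ , ad′ , bc′ , bd′ , cd′)

  blueSafe : ∀ {b} → BlueSafe b q
  blueSafe x y (_ , _ , _ , ¬red , _) = NewEdge.noK4 ¬red

module Pattern (t : PType) where

  V : Set
  V = Fin (nv t)

  Edge : Set
  Edge = V × V

  -- R and B are the edges red and blue have added to the pattern, latest first.
  Red : List Edge → V → V → Set
  Red R i j = (i , j) ∈L (redE t ++ R)

  Blue : List Edge → V → V → Set
  Blue B i j = (i , j) ∈L (blueE t ++ B)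

  FreeIn : List Edge → List Edge → V → V → Set
  FreeIn R B i j = i ≢ j × ¬ Red R i j × ¬ Blue B i j

  Distinct4ᶠ : V → V → V → V → Set
  Distinct4ᶠ a b c d = a ≢ b × a ≢ c × a ≢ d × b ≢ c × b ≢ d × c ≢ d

  ThreatIn : List Edge → List Edge → V → V → V → V → Set
  ThreatIn R B x y c d = Distinct4ᶠ x y c d
    × Red R x c × Red R x d × Red R y c × Red R y d × Red R c d
    × ¬ Red R x y × ¬ Blue B x y

  -- `force u v x y c d`: red claims uv, threatening xy on {x,y,c,d}, and blue claims xy;
  -- `fork` is a final red move with two threats.
  data Plan : List Edge → List Edge → Set where
    fork  : ∀ {R B} (u v x₁ y₁ c₁ d₁ x₂ y₂ c₂ d₂ : V) → Plan R B
    force : ∀ {R B} (u v x y c d : V) → Plan ((u , v) ∷ R) ((x , y) ∷ B) → Plan R B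

  Valid : ∀ {R B} → Plan R B → Set
  Valid {R} {B} (fork u v x₁ y₁ c₁ d₁ x₂ y₂ c₂ d₂) = FreeIn R B u v
    × ThreatIn ((u , v) ∷ R) B x₁ y₁ c₁ d₁ × ThreatIn ((u , v) ∷ R) B x₂ y₂ c₂ d₂
    × ¬ (x₁ , y₁) ∈L ((x₂ , y₂) ∷ [])
  Valid {R} {B} (force u v x y c d plan) = FreeIn R B u v
    × ThreatIn ((u , v) ∷ R) B x y c d × (x , y) ∈L vulnE t × Valid plan

  private
    _≟ᵉ_ : (e f : Edge) → Dec (e ≡ f)
    _≟ᵉ_ = ≡-dec Fin._≟_ Fin._≟_

    open DecMembership _≟ᵉ_ using (_∈?_)

    _∈L?_ : (e : Edge) (es : List Edge) → Dec (e ∈L es)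
    (i , j) ∈L? es = ((i , j) ∈? es) ⊎-dec ((j , i) ∈? es)

    _≢?_ : (i j : V) → Dec (i ≢ j)
    i ≢? j = ¬? (i Fin.≟ j)

    freeIn? : ∀ R B i j → Dec (FreeIn R B i j)
    freeIn? R B i j = (i ≢? j) ×-dec ¬? ((i , j) ∈L? (redE t ++ R)) ×-dec ¬? ((i , j) ∈L? (blueE t ++ B))

    threatIn? : ∀ R B x y c d → Dec (ThreatIn R B x y c d)
    threatIn? R B x y c d =
      ((x ≢? y) ×-dec (x ≢? c) ×-dec (x ≢? d) ×-dec (y ≢? c) ×-dec (y ≢? d) ×-dec (c ≢? d))
      ×-dec red? x c ×-dec red? x d ×-dec red? y c ×-dec red? y d ×-dec red? c d
      ×-dec ¬? (red? x y) ×-dec ¬? ((x , y) ∈L? (blueE t ++ B))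
      where
      red? : ∀ i j → Dec (Red R i j)
      red? i j = (i , j) ∈L? (redE t ++ R)

  valid? : ∀ {R B} (plan : Plan R B) → Dec (Valid plan)
  valid? {R} {B} (fork u v x₁ y₁ c₁ d₁ x₂ y₂ c₂ d₂) = freeIn? R B u v
    ×-dec threatIn? _ B x₁ y₁ c₁ d₁ ×-dec threatIn? _ B x₂ y₂ c₂ d₂
    ×-dec ¬? ((x₁ , y₁) ∈L? ((x₂ , y₂) ∷ []))
  valid? {R} {B} (force u v x y c d plan) = freeIn? R B u v
    ×-dec threatIn? _ B x y c d ×-dec ((x , y) ∈L? vulnE t) ×-dec valid? plan

open Pattern using (Plan; Valid; valid?; fork; force)

strategy : (t : PType) → Plan t [] []
strategy T1 = fork (# 2) (# 4) (# 1) (# 4) (# 0) (# 2) (# 3) (# 4) (# 0) (# 2)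
strategy T2 = force (# 2) (# 3) (# 1) (# 3) (# 0) (# 2)
             (fork (# 2) (# 4) (# 1) (# 4) (# 0) (# 2) (# 3) (# 4) (# 0) (# 2))
strategy T3 = force (# 2) (# 5) (# 1) (# 5) (# 0) (# 2)
             (force (# 4) (# 5) (# 2) (# 4) (# 0) (# 5)
             (fork (# 3) (# 5) (# 2) (# 3) (# 0) (# 5) (# 3) (# 4) (# 0) (# 5)))
strategy T4 = force (# 2) (# 4) (# 1) (# 4) (# 0) (# 2)
             (force (# 2) (# 5) (# 1) (# 5) (# 0) (# 2)
             (fork (# 2) (# 3) (# 3) (# 4) (# 0) (# 2) (# 3) (# 5) (# 0) (# 2)))
strategy T5 = force (# 2) (# 6) (# 1) (# 6) (# 0) (# 2)
             (force (# 3) (# 6) (# 2) (# 3) (# 0) (# 6)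
             (force (# 5) (# 6) (# 2) (# 5) (# 0) (# 6)
             (fork (# 4) (# 6) (# 3) (# 4) (# 0) (# 6) (# 4) (# 5) (# 0) (# 6))))
strategy T6 = force (# 2) (# 6) (# 1) (# 6) (# 0) (# 2)
             (force (# 5) (# 6) (# 2) (# 5) (# 0) (# 6)
             (force (# 4) (# 6) (# 4) (# 5) (# 0) (# 6)
             (fork (# 3) (# 6) (# 3) (# 4) (# 0) (# 6) (# 3) (# 5) (# 0) (# 6))))

strategy-valid : (t : PType) → Valid t (strategy t)
strategy-valid T1 = toWitness {a? = valid? T1 (strategy T1)} tt
strategy-valid T2 = toWitness {a? = valid? T2 (strategy T2)} tt
strategy-valid T3 = toWitness {a? = valid? T3 (strategy T3)} tt
strategy-valid T4 = toWitness {a? = valid? T4 (strategy T4)} tt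
strategy-valid T5 = toWitness {a? = valid? T5 (strategy T5)} tt
strategy-valid T6 = toWitness {a? = valid? T6 (strategy T6)} tt

module Realisation {b p t φ} (realised : Realised b p t φ) where

  open Pattern t using (Edge; Red; Blue; FreeIn; ThreatIn)

  φ² : Edge → ℕ × ℕ
  φ² e = φ (proj₁ e) , φ (proj₂ e)

  -- `lift [] []` is p and `lift [] (vulnE t)` is `addVulnerable p t φ`, definitionally.
  lift : List Edge → List Edge → Pos
  lift R B = pos (map φ² R ++ reds p) (map φ² B ++ blues p)

  inBoard : ∀ i → InBoard b (φ i)
  inBoard = proj₁ realised

  φ-injective : ∀ {i j} → φ i ≡ φ j → i ≡ j
  φ-injective = proj₁ (proj₂ realised) _ _

  φ-≢ : ∀ {i j} → i ≢ j → φ i ≢ φ j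
  φ-≢ i≢j = i≢j ∘ φ-injective

  ∈-map-φ²⁻ : ∀ {i j es} → (φ i , φ j) ∈ map φ² es → (i , j) ∈ es
  ∈-map-φ²⁻ m with ∈-map⁻ φ² m
  ... | _ , kl∈es , eq with φ-injective (,-injectiveˡ eq) | φ-injective (,-injectiveʳ eq)
  ... | refl | refl = kl∈es

  ∈ᵘ-map-φ² : ∀ {i j es} → (φ i , φ j) ∈ᵘ map φ² es ⇔ (i , j) ∈ᵘ es
  ∈ᵘ-map-φ² = mk⇔ (Sum.map ∈-map-φ²⁻ ∈-map-φ²⁻) (Sum.map (∈-map⁺ φ²) (∈-map⁺ φ²))

  ∈ᵘ-map-φ²-mono : ∀ {u v es fs} → (∀ {k l} → (k , l) ∈ es → (k , l) ∈ᵘ fs)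
                 → (u , v) ∈ᵘ map φ² es → (u , v) ∈ᵘ map φ² fs
  ∈ᵘ-map-φ²-mono es⊆fs (inj₁ m) with ∈-map⁻ φ² m
  ... | _ , kl∈es , refl = from ∈ᵘ-map-φ² (es⊆fs kl∈es)
  ∈ᵘ-map-φ²-mono es⊆fs (inj₂ m) with ∈-map⁻ φ² m
  ... | _ , kl∈es , refl = Sum.swap (from ∈ᵘ-map-φ² (es⊆fs kl∈es))

  ∈ᵘ-lift : ∀ {ns es added i j} → ((φ i , φ j) ∈ᵘ ns ⇔ (i , j) ∈ᵘ es)
          → (φ i , φ j) ∈ᵘ (map φ² added ++ ns) ⇔ (i , j) ∈ᵘ (es ++ added)
  ∈ᵘ-lift {ns} {es} {added} ns⇔es = mk⇔
    (Sum.[ ∈ᵘ-++⁺ʳ es ∘ to ∈ᵘ-map-φ² , ∈ᵘ-++⁺ˡ ∘ to ns⇔es ] ∘ ∈ᵘ-++⁻ (map φ² added))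
    (Sum.[ ∈ᵘ-++⁺ʳ (map φ² added) ∘ from ns⇔es , ∈ᵘ-++⁺ˡ ∘ from ∈ᵘ-map-φ² ] ∘ ∈ᵘ-++⁻ es)

  red-lift : ∀ {R B i j} → i ≢ j → Claimed red (lift R B) (φ i) (φ j) ⇔ Red R i j
  red-lift i≢j = ∈ᵘ-lift (uncurry mk⇔ (proj₁ (proj₂ (proj₂ realised) _ _ i≢j)))

  blue-lift : ∀ {R B i j} → i ≢ j → Claimed blue (lift R B) (φ i) (φ j) ⇔ Blue B i j
  blue-lift i≢j = ∈ᵘ-lift (uncurry mk⇔ (proj₂ (proj₂ (proj₂ realised) _ _ i≢j)))

  Free-lift : ∀ {R B u v} → FreeIn R B u v → Free b (lift R B) (φ u) (φ v)
  Free-lift {R} {B} {u} {v} (u≢v , ¬red , ¬blue) =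
    inBoard u , inBoard v , φ-≢ u≢v , ¬red ∘ to (red-lift {R} {B} u≢v) , ¬blue ∘ to (blue-lift {R} {B} u≢v)

  ThreatAt-lift : ∀ {R B x y c d} → ThreatIn R B x y c d → ThreatAt red (lift R B) (φ x) (φ y)
  ThreatAt-lift {R} {B} {c = c} {d} ((x≢y , x≢c , x≢d , y≢c , y≢d , c≢d) , xc , xd , yc , yd , cd , ¬red , ¬blue) =
    φ c , φ d , (φ-≢ x≢y , φ-≢ x≢c , φ-≢ x≢d , φ-≢ y≢c , φ-≢ y≢d , φ-≢ c≢d)
    , claim x≢c xc , claim x≢d xd , claim y≢c yc , claim y≢d yd , claim c≢d cd
    , ¬red ∘ to (red-lift {R} {B} x≢y) , ¬blue ∘ to (blue-lift {R} {B} x≢y)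
    where
    claim : ∀ {i j} → i ≢ j → Red R i j → Claimed red (lift R B) (φ i) (φ j)
    claim i≢j = from (red-lift {R} {B} i≢j)

  SameEdge-lift : ∀ {x₁ y₁ x₂ y₂} → SameEdge (φ x₁ , φ y₁) (φ x₂ , φ y₂) → (x₁ , y₁) ∈L ((x₂ , y₂) ∷ [])
  SameEdge-lift = to ∈ᵘ-map-φ² ∘ SameEdge⇒∈ᵘ

  threatSequence : ∀ {R B} (plan : Plan t R B) → Valid t plan → ThreatSequence b (lift R B)
  threatSequence (fork u v x₁ y₁ _ _ x₂ y₂ _ _) (free , threat₁ , threat₂ , distinct) =
    last (φ u) (φ v) (φ x₁) (φ y₁) (φ x₂) (φ y₂) (Free-lift free)
      (ThreatAt-lift threat₁) (ThreatAt-lift threat₂) (distinct ∘ SameEdge-lift)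
  threatSequence (force u v x y _ _ plan) (free , threat , _ , valid) =
    step (φ u) (φ v) (φ x) (φ y) (Free-lift free) (ThreatAt-lift threat) (threatSequence plan valid)

  module _ (¬K4 : ¬ K4 blue (addVulnerable p t φ)) (¬threat : ¬ Threat blue (addVulnerable p t φ)) where

    lift-safe : ∀ {R B} → (∀ {k l} → (k , l) ∈ B → (k , l) ∈L vulnE t) → BlueSafe b (lift R B)
    lift-safe {R} {B} B⊆vulnerable = blueSafe blue⊆ red⊇ ¬K4 ¬threat
      where
      blue⊆ : ∀ u v → Claimed blue (lift R B) u v → Claimed blue (addVulnerable p t φ) u v
      blue⊆ u v = Sum.[ ∈ᵘ-++⁺ˡ ∘ ∈ᵘ-map-φ²-mono B⊆vulnerable , ∈ᵘ-++⁺ʳ _ ] ∘ ∈ᵘ-++⁻ (map φ² B)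
      red⊇ : ∀ u v → Claimed red (addVulnerable p t φ) u v → Claimed red (lift R B) u v
      red⊇ u v = ∈ᵘ-++⁺ʳ (map φ² R)

    redWins : ∀ {R B} (plan : Plan t R B) → Valid t plan
            → (∀ {k l} → (k , l) ∈ B → (k , l) ∈L vulnE t) → RedWins b (lift R B)
    redWins (fork u v x₁ y₁ _ _ x₂ y₂ _ _) (free , threat₁ , threat₂ , distinct) B⊆vulnerable =
      doubleThreat (Free-lift free) (lift-safe B⊆vulnerable)
        (inBoard x₁) (inBoard y₁) (inBoard x₂) (inBoard y₂)
        (ThreatAt-lift threat₁) (ThreatAt-lift threat₂) (distinct ∘ SameEdge-lift)
    redWins {B = B} (force u v x y _ _ plan) (free , threat , xy-vulnerable , valid) B⊆vulnerable =
      forcingMove (Free-lift free) (lift-safe B⊆vulnerable) (inBoard x) (inBoard y)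
        (ThreatAt-lift threat) (redWins plan valid B′⊆vulnerable)
      where
      B′⊆vulnerable : ∀ {k l} → (k , l) ∈ (x , y) ∷ B → (k , l) ∈L vulnE t
      B′⊆vulnerable (here refl) = xy-vulnerable
      B′⊆vulnerable (there m)   = B⊆vulnerable m

-- The hypotheses on p itself follow from those on the position with the vulnerable edges
-- added, and neither legality nor whose turn it is matters for red's forcing play.
lemma4p2 : (b : Board) (p : Pos) (t : PType) (φ : Fin (nv t) → ℕ)
    → Legal b p
    → RedsTurn p
    → Realised b p t φ
    → ¬ MonoK4 p
    → ¬ MonoK4 (addVulnerable p t φ)
    → ¬ Threat blue p
    → ¬ Threat blue (addVulnerable p t φ)
    → ThreatSequence b p × RedWins b p
lemma4p2 b p t φ _ _ realised _ ¬monoK4 _ ¬threat =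
  threatSequence (strategy t) (strategy-valid t) ,
  redWins (¬monoK4 ∘ inj₂) ¬threat (strategy t) (strategy-valid t) λ ()
  where open Realisation realised
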